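{- Let $k\ge2$, $n\ge0$ and $T\in\mathcal{T}^k_n$. Let $\phi(T)$ be the sequence obtained as follows: first give every half-edge at each non-root vertex $v$ the label of the edge between $v$ and its parent; then traverse the edges and half-edges of $T$ by a depth-first walk from left to right (counterclockwise around each vertex), recording labels as they are traversed, where each edge contributes its label twice (once in each direction) and each half-edge contributes its label once. Then $\phi(T)\in\overline{\mathcal{Q}}^k_n$ and $$\operatorname{asc}(\phi(T))=\operatorname{casc}(T),\quad \operatorname{des}(\phi(T))=\operatorname{cdes}(T),\quad \operatorname{plat}(\phi(T))=\operatorname{emp}(T).$$ (The map $\phi:\mathcal{T}^k_n\to\overline{\mathcal{Q}}^k_n$ is a bijection.)
   Context: For a sequence $\pi=\pi_1\cdots\pi_r$: $i\in\{1,\dots,r\}$ is a descent if $\pi_i>\pi_{i+1}$ or $i=r$; $i\in\{0,\dots,r-1\}$ is an ascent if $\pi_i<\pi_{i+1}$ or $i=0$; $i\in\{1,\dots,r-1\}$ is a plateau if $\pi_i=\pi_{i+1}$. Cyclic descents and ascents: $\operatorname{cdes}(\pi)=|\{i\in[r]:\pi_i>\pi_{i+1}\}|$, $\operatorname{casc}(\pi)=|\{i\in[r]:\pi_i<\pi_{i+1}\}|$, with $\pi_{r+1}:=\pi_1$. $\overline{\mathcal{Q}}^k_n$ is the set of permutations of $\{1^k,\dots,n^k\}$ avoiding $1212$ and $2121$ (no $i<j<l<m$ with $\pi_i=\pi_l\ne\pi_j=\pi_m$). $\mathcal{T}^k_n$ is the set of plane rooted trees with $n$ edges labeled bijectively by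 $[n]$, where every non-root vertex carries $k-2$ unlabeled half-edges separating its ordered children into $k-1$ consecutive possibly empty compartments. For a non-root vertex $v$ whose parent edge has label $\ell$ and whose child edges in the $j$-th compartment have labels $a_{j,1},\dots,a_{j,d_j}$ left to right ($1\le j\le k-1$), set $\operatorname{cdes}(v)=\operatorname{cdes}(\ell a_{1,1}\cdots a_{1,d_1}\ell a_{2,1}\cdots a_{2,d_2}\ell\cdots\ell a_{k-1,1}\cdots a_{k-1,d_{k-1}})$ and $\operatorname{casc}(v)$ likewise with $\operatorname{casc}$. For the root with child-edge labels $a_1,\dots,a_d$ left to right, $\operatorname{cdes}(v)=\operatorname{des}(a_1\cdots a_d)$ and $\operatorname{casc}(v)=\operatorname{asc}(a_1\cdots a_d)$. Then $\operatorname{cdes}(T)=\sum_v\operatorname{cdes}(v)$, $\operatorname{casc}(T)=\sum_v\operatorname{casc}(v)$, and $\operatorname{emp}(T)$ is the total number of empty compartments over all non-root vertices. -}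

module Defs where

open import Data.Nat using (ℕ; zero; suc; _+_; _∸_; _<_; _<ᵇ_; _≡ᵇ_)
open import Data.Bool using (Bool; true; false; if_then_else_)
open import Data.Product using (_×_; _,_; proj₁; proj₂; ∃)
open import Data.List using (List; []; _∷_; _++_; map; concat; concatMap; replicate; upTo; length; lookup; sum; [_])
open import Data.Vec using (Vec) renaming ([] to []v; _∷_ to _∷v_)
open import Data.Fin using (Fin; toℕ)
open import Relation.Binary.PropositionalEquality using (_≡_)
open import Data.List.Relation.Binary.Permutation.Propositional using (_↭_)

ind : Bool → ℕ
ind true  = 1
ind false = 0

ndes nasc nplat : List ℕ → ℕ
ndes []           = 0
ndes (x ∷ [])     = 0
ndes (x ∷ y ∷ r)  = ind (y <ᵇ x) + ndes (y ∷ r)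
nasc []           = 0
nasc (x ∷ [])     = 0
nasc (x ∷ y ∷ r)  = ind (x <ᵇ y) + nasc (y ∷ r)
nplat []          = 0
nplat (x ∷ [])    = 0
nplat (x ∷ y ∷ r) = ind (x ≡ᵇ y) + nplat (y ∷ r)

-- des: i ∈ [r] with π_i > π_{i+1} or i = r
des : List ℕ → ℕ
des []      = 0
des (x ∷ r) = suc (ndes (x ∷ r))

-- asc: i ∈ {0..r-1} with π_i < π_{i+1} or i = 0
asc : List ℕ → ℕ
asc []      = 0
asc (x ∷ r) = suc (nasc (x ∷ r))

plat : List ℕ → ℕ
plat = nplat

cdes casc : List ℕ → ℕ
cdes []      = 0
cdes (x ∷ r) = ndes ((x ∷ r) ++ [ x ])
casc []      = 0
casc (x ∷ r) = nasc ((x ∷ r) ++ [ x ])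

oneTo : ℕ → List ℕ
oneTo n = map suc (upTo n)

IsMultiPerm : ℕ → ℕ → List ℕ → Set
IsMultiPerm k n π = π ↭ concatMap (replicate k) (oneTo n)

_<F_ : ∀ {m} → Fin m → Fin m → Set
i <F j = toℕ i < toℕ j

-- avoids 1212 and 2121: no i<j<l<m with π_i = π_l ≠ π_j = π_m
Avoids1212 : List ℕ → Set
Avoids1212 π = (i j l m : Fin (length π)) → i <F j → j <F l → l <F m →
  lookup π i ≡ lookup π l → lookup π j ≡ lookup π m → lookup π i ≡ lookup π j

InQ : ℕ → ℕ → List ℕ → Set
InQ k n π = IsMultiPerm k n π × Avoids1212 π

-- A non-root vertex is given by its k-1 compartments (ordered, left to
-- right); each compartment is the list (left to right) of its child edges,
-- an edge being a pair (label , subtree below it). The k-2 half-edges sit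
-- between consecutive compartments.  A tree is given by the list of child
-- edges of the root, left to right.

data NTree (k : ℕ) : Set where
  node : Vec (List (ℕ × NTree k)) (k ∸ 1) → NTree k

Tree : ℕ → Set
Tree k = List (ℕ × NTree k)

mutual
  labelsE : ∀ {k} → List (ℕ × NTree k) → List ℕ
  labelsE []            = []
  labelsE ((a , t) ∷ es) = a ∷ labelsV t ++ labelsE es

  labelsV : ∀ {k} → NTree k → List ℕ
  labelsV (node cs) = labelsC cs

  labelsC : ∀ {k m} → Vec (List (ℕ × NTree k)) m → List ℕ
  labelsC []v        = []
  labelsC (c ∷v cs)  = labelsE c ++ labelsC cs

InT : (k n : ℕ) → Tree k → Set
InT k n t = labelsE t ↭ oneTo n

vword : ∀ {k m} → ℕ → Vec (List (ℕ × NTree k)) m → List ℕ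
vword ℓ []v       = []
vword ℓ (c ∷v cs) = ℓ ∷ map proj₁ c ++ vword ℓ cs

mutual
  cdesE : ∀ {k} → List (ℕ × NTree k) → ℕ
  cdesE []             = 0
  cdesE ((a , t) ∷ es) = cdesV a t + cdesE es

  cdesV : ∀ {k} → ℕ → NTree k → ℕ
  cdesV ℓ (node cs) = cdes (vword ℓ cs) + cdesC cs

  cdesC : ∀ {k m} → Vec (List (ℕ × NTree k)) m → ℕ
  cdesC []v       = 0
  cdesC (c ∷v cs) = cdesE c + cdesC cs

mutual
  cascE : ∀ {k} → List (ℕ × NTree k) → ℕ
  cascE []             = 0
  cascE ((a , t) ∷ es) = cascV a t + cascE es

  cascV : ∀ {k} → ℕ → NTree k → ℕ
  cascV ℓ (node cs) = casc (vword ℓ cs) + cascC cs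

  cascC : ∀ {k m} → Vec (List (ℕ × NTree k)) m → ℕ
  cascC []v       = 0
  cascC (c ∷v cs) = cascE c + cascC cs

mutual
  empE : ∀ {k} → List (ℕ × NTree k) → ℕ
  empE []             = 0
  empE ((a , t) ∷ es) = empV t + empE es

  empV : ∀ {k} → NTree k → ℕ
  empV (node cs) = empC cs

  empC : ∀ {k m} → Vec (List (ℕ × NTree k)) m → ℕ
  empC []v        = 0
  empC ([] ∷v cs) = suc (empC cs)
  empC (c@(_ ∷ _) ∷v cs) = empE c + empC cs

cdesT : ∀ {k} → Tree k → ℕ
cdesT t = des (map proj₁ t) + cdesE t

cascT : ∀ {k} → Tree k → ℕ
cascT t = asc (map proj₁ t) + cascE t

empT : ∀ {k} → Tree k → ℕ
empT = empE

-- Going down an edge a records a; at the child vertex, compartments are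
-- visited in order with a half-edge (label a) recorded between consecutive
-- ones; coming back up records a again.  Thus an edge a with compartments
-- C_1..C_{k-1} contributes  a W(C_1) a W(C_2) a ... a W(C_{k-1}) a.

mutual
  φE : ∀ {k} → List (ℕ × NTree k) → List ℕ
  φE []             = []
  φE ((a , node cs) ∷ es) = a ∷ φC a cs ++ (a ∷ φE es)

  φC : ∀ {k m} → ℕ → Vec (List (ℕ × NTree k)) m → List ℕ
  φC a []v              = []
  φC a (c ∷v []v)       = φE c
  φC a (c ∷v (d ∷v cs)) = φE c ++ (a ∷ φC a (d ∷v cs))

φ : ∀ {k} → Tree k → List ℕ
φ = φE

-- In φ(T) the label a of an edge occurs exactly k times: on the way down the edge, at each of the
-- k − 2 half-edges below it and on the way back up, and between two consecutive occurrences the walk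
-- stays inside one compartment of the child vertex.  Hence the occurrences of distinct labels are
-- nested or disjoint, which is avoidance of 1212 and 2121; conversely, cutting such a word at the
-- occurrences of its first letter recovers the compartments, and by recursion the tree, uniquely.
-- Two consecutive letters of φ(T) are either consecutive children of the root or cyclically
-- consecutive in the word ℓ a₁… ℓ … ℓ a_{k−1}… of a non-root vertex, so every count of adjacent
-- pairs splits into a root term and cyclic vertex terms; as the labels are distinct, equal
-- neighbours ℓ ℓ arise exactly at empty compartments.

module Submission where

open import Defs
open import Data.Nat using (ℕ; zero; suc; _+_; _*_; _≤_; _<_; z≤n; s≤s; _≡ᵇ_; _<ᵇ_; _≟_)
open import Data.Nat.Properties
  using (module ≤-Reasoning; +-assoc; +-identityʳ; +-suc; +-cancelˡ-≡; +-monoʳ-≤; m≤m+n; m≤n+m; ≤-trans; ≤-reflexive; ≤-refl; ≤-pred;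
         suc-injective; 1+n≢0; n≢0⇒n>0; n≤1⇒n≡0∨n≡1; n≤0⇒n≡0; <-irrefl; +-commutativeSemigroup; m+n≡0⇒m≡0; m+n≡0⇒n≡0; *-zeroʳ; *-identityʳ; *-distribˡ-+; *-cancelˡ-≡)
open import Data.Nat.Tactic.RingSolver using (solve-∀)
open import Data.Bool using (Bool)
open import Data.List using (List; []; _∷_; _++_; map; concatMap; replicate; length; lookup; [_])
open import Data.List.Properties using (++-assoc; ++-identityʳ; ∷-injective)
open import Data.List.Relation.Unary.All using (All; []; _∷_)
open import Data.List.Relation.Unary.Unique.Propositional using (Unique; []; _∷_)
open import Data.List.Relation.Unary.Unique.Propositional.Properties using (upTo⁺) renaming (map⁺ to Unique-map⁺)
open import Data.List.Relation.Binary.Permutation.Propositional using (_↭_; prep; swap; ↭-sym; ↭-refl; ↭-trans)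
import Data.List.Relation.Binary.Permutation.Propositional as ↭
open import Data.List.Relation.Binary.Permutation.Propositional.Properties using (shift; ∷↭∷ʳ)
open import Data.List.Relation.Binary.Sublist.Propositional using (_⊆_; []; _∷_; _∷ʳ_; ⊆-refl; ⊆-trans; minimum)
open import Data.List.Relation.Binary.Sublist.Propositional.Properties using (++⁺; ++⁺ˡ; ++⁺ʳ; length-mono-≤)
open import Data.Vec using (Vec) renaming ([] to []v; _∷_ to _∷v_)
open import Data.Fin using (Fin) renaming (zero to fz; suc to fs)
open import Data.Product using (_×_; _,_; proj₁; proj₂; ∃; ∃₂)
open import Data.Sum using (_⊎_; inj₁; inj₂)
import Data.Sum as Sum
open import Data.Empty using (⊥; ⊥-elim)
open import Function using (_∘_; flip)
open import Relation.Nullary using (yes; no)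
open import Relation.Binary.PropositionalEquality using (_≡_; _≢_; refl; sym; trans; cong; cong₂; subst; subst₂; module ≡-Reasoning)
open import Algebra.Properties.CommutativeSemigroup +-commutativeSemigroup using (x∙yz≈y∙xz)

δ : ℕ → ℕ → ℕ
δ x y = ind (x ≡ᵇ y)

δ-refl : ∀ x → δ x x ≡ 1
δ-refl zero    = refl
δ-refl (suc x) = δ-refl x

δ-≢ : ∀ {x y} → x ≢ y → δ x y ≡ 0
δ-≢ {zero}  {zero}  x≢y = ⊥-elim (x≢y refl)
δ-≢ {zero}  {suc y} x≢y = refl
δ-≢ {suc x} {zero}  x≢y = refl
δ-≢ {suc x} {suc y} x≢y = δ-≢ (x≢y ∘ cong suc)

occ : ℕ → List ℕ → ℕ
occ x []       = 0
occ x (y ∷ ys) = δ x y + occ x ys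

occ-head : ∀ x ys → occ x (x ∷ ys) ≡ suc (occ x ys)
occ-head x ys = cong (_+ occ x ys) (δ-refl x)

occ-++ : ∀ x u v → occ x (u ++ v) ≡ occ x u + occ x v
occ-++ x []      v = refl
occ-++ x (y ∷ u) v = trans (cong (δ x y +_) (occ-++ x u v)) (sym (+-assoc (δ x y) _ _))

occ-split : ∀ x ys → 0 < occ x ys → ∃₂ λ p q → ys ≡ p ++ x ∷ q × occ x p ≡ 0
occ-split x (y ∷ ys) x∈ys with x ≟ y
... | yes refl = [] , ys , refl , refl
... | no x≢y rewrite δ-≢ x≢y with occ-split x ys x∈ys
...   | p , q , refl , x∉p = y ∷ p , q , refl , trans (cong (_+ occ x p) (δ-≢ x≢y)) x∉p

↭⇒occ≡ : ∀ {xs ys} → xs ↭ ys → ∀ z → occ z xs ≡ occ z ys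
↭⇒occ≡ ↭.refl          z = refl
↭⇒occ≡ (prep x p)      z = cong (δ z x +_) (↭⇒occ≡ p z)
↭⇒occ≡ (swap x y p)    z rewrite ↭⇒occ≡ p z = x∙yz≈y∙xz (δ z x) (δ z y) _
↭⇒occ≡ (↭.trans p q)   z = trans (↭⇒occ≡ p z) (↭⇒occ≡ q z)

occ≡⇒↭ : ∀ xs ys → (∀ z → occ z xs ≡ occ z ys) → xs ↭ ys
occ≡⇒↭ []       []       _  = ↭-refl
occ≡⇒↭ []       (y ∷ ys) eq with trans (eq y) (occ-head y ys)
... | ()
occ≡⇒↭ (x ∷ xs) ys       eq
  with occ-split x ys (subst (0 <_) (trans (sym (occ-head x xs)) (eq x)) (s≤s z≤n))
... | p , q , refl , _ = ↭-trans (prep x (occ≡⇒↭ xs (p ++ q) eq′)) (↭-sym (shift x p q))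
  where
  eq′ : ∀ z → occ z xs ≡ occ z (p ++ q)
  eq′ z = +-cancelˡ-≡ (δ z x) _ _ (begin
    δ z x + occ z xs              ≡⟨ eq z ⟩
    occ z (p ++ x ∷ q)            ≡⟨ occ-++ z p (x ∷ q) ⟩
    occ z p + (δ z x + occ z q)   ≡⟨ x∙yz≈y∙xz (occ z p) (δ z x) (occ z q) ⟩
    δ z x + (occ z p + occ z q)   ≡⟨ cong (δ z x +_) (occ-++ z p q) ⟨
    δ z x + occ z (p ++ q)        ∎)
    where open ≡-Reasoning

split-unique : ∀ a u u′ {v v′} → occ a u ≡ 0 → occ a u′ ≡ 0 → u ++ a ∷ v ≡ u′ ++ a ∷ v′ → u ≡ u′ × v ≡ v′
split-unique a []      []       _   _    eq   = refl , proj₂ (∷-injective eq)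
split-unique a []      (._ ∷ u′) _   a∉u′ refl = ⊥-elim (1+n≢0 (trans (sym (occ-head a u′)) a∉u′))
split-unique a (._ ∷ u) []       a∉u _    refl = ⊥-elim (1+n≢0 (trans (sym (occ-head a u)) a∉u))
split-unique a (y ∷ u) (y′ ∷ u′) a∉u a∉u′ eq with ∷-injective eq
... | refl , eq′ with split-unique a u u′ (m+n≡0⇒n≡0 (δ a y) a∉u) (m+n≡0⇒n≡0 (δ a y) a∉u′) eq′
...   | refl , refl = refl , refl

occ-concatMap-replicate : ∀ m x L → occ x (concatMap (replicate m) L) ≡ m * occ x L
occ-concatMap-replicate m x []      = sym (*-zeroʳ m)
occ-concatMap-replicate m x (y ∷ L) = begin
  occ x (replicate m y ++ concatMap (replicate m) L)  ≡⟨ occ-++ x (replicate m y) _ ⟩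
  occ x (replicate m y) + occ x (concatMap (replicate m) L)
    ≡⟨ cong₂ _+_ (occ-replicate m) (occ-concatMap-replicate m x L) ⟩
  m * δ x y + m * occ x L                             ≡⟨ *-distribˡ-+ m (δ x y) (occ x L) ⟨
  m * occ x (y ∷ L)                                   ∎
  where
  open ≡-Reasoning
  occ-replicate : ∀ m → occ x (replicate m y) ≡ m * δ x y
  occ-replicate zero    = refl
  occ-replicate (suc m) = cong (δ x y +_) (occ-replicate m)

record Distinct (L : List ℕ) : Set where
  constructor distinct
  field occ≤1 : ∀ x → occ x L ≤ 1
open Distinct

record Disjoint (u v : List ℕ) : Set where
  constructor disjoint
  field occ≡0 : ∀ x → occ x u ≡ 0 ⊎ occ x v ≡ 0
open Disjoint

Distinct-occ-mono : ∀ {L M} → (∀ x → occ x M ≤ occ x L) → Distinct L → Distinct M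
Distinct-occ-mono M≤L d = distinct λ x → ≤-trans (M≤L x) (occ≤1 d x)

Distinct-resp-↭ : ∀ {L M} → L ↭ M → Distinct L → Distinct M
Distinct-resp-↭ L↭M = Distinct-occ-mono (λ x → ≤-reflexive (sym (↭⇒occ≡ L↭M x)))

Distinct-tail : ∀ {a L} → Distinct (a ∷ L) → Distinct L
Distinct-tail {a} = Distinct-occ-mono (λ x → m≤n+m _ (δ x a))

Distinct-head : ∀ {a L} → Distinct (a ∷ L) → occ a L ≡ 0
Distinct-head {a} {L} d = n≤0⇒n≡0 (≤-pred (subst (_≤ 1) (occ-head a L) (occ≤1 d a)))

Distinct-++ˡ : ∀ L {M} → Distinct (L ++ M) → Distinct L
Distinct-++ˡ L {M} = Distinct-occ-mono (λ x → subst (occ x L ≤_) (sym (occ-++ x L M)) (m≤m+n _ _))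

Distinct-++ʳ : ∀ L {M} → Distinct (L ++ M) → Distinct M
Distinct-++ʳ L {M} = Distinct-occ-mono (λ x → subst (occ x M ≤_) (sym (occ-++ x L M)) (m≤n+m _ _))

m+n≤1⇒m≡0⊎n≡0 : ∀ m n → m + n ≤ 1 → m ≡ 0 ⊎ n ≡ 0
m+n≤1⇒m≡0⊎n≡0 zero    n       _ = inj₁ refl
m+n≤1⇒m≡0⊎n≡0 (suc m) zero    _ = inj₂ refl
m+n≤1⇒m≡0⊎n≡0 (suc m) (suc n) (s≤s m+1+n≤0) with subst (_≤ 0) (+-suc m n) m+1+n≤0
... | ()

Distinct-++⇒Disjoint : ∀ L {M} → Distinct (L ++ M) → Disjoint L M
Distinct-++⇒Disjoint L {M} d =
  disjoint λ x → m+n≤1⇒m≡0⊎n≡0 (occ x L) (occ x M) (subst (_≤ 1) (occ-++ x L M) (occ≤1 d x))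

All≢⇒occ≡0 : ∀ {y L} → All (y ≢_) L → occ y L ≡ 0
All≢⇒occ≡0 []           = refl
All≢⇒occ≡0 (y≢z ∷ y∉L) = cong₂ _+_ (δ-≢ y≢z) (All≢⇒occ≡0 y∉L)

Unique⇒Distinct : ∀ {L} → Unique L → Distinct L
Unique⇒Distinct []                    = distinct λ _ → z≤n
Unique⇒Distinct {y ∷ L} (y∉L ∷ uniq) = distinct occ≤1′
  where
  occ≤1′ : ∀ x → occ x (y ∷ L) ≤ 1
  occ≤1′ x with x ≟ y
  ... | yes refl = ≤-reflexive (trans (occ-head x L) (cong suc (All≢⇒occ≡0 y∉L)))
  ... | no x≢y rewrite δ-≢ x≢y = occ≤1 (Unique⇒Distinct uniq) x

Distinct-oneTo : ∀ n → Distinct (oneTo n)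
Distinct-oneTo n = Unique⇒Distinct (Unique-map⁺ suc-injective (upTo⁺ n))

Distinct-shift : ∀ {a} L {R} → Distinct (a ∷ L ++ R) → Distinct (L ++ a ∷ R)
Distinct-shift {a} L {R} = Distinct-resp-↭ (↭-sym (shift a L R))

Distinct-∷-++⇒∉ : ∀ {a} L {R} → Distinct (a ∷ L ++ R) → occ a L ≡ 0
Distinct-∷-++⇒∉ {a} L {R} d = m+n≡0⇒m≡0 (occ a L) (trans (sym (occ-++ a L R)) (Distinct-head d))

Distinct-∷-++⇒Distinctˡ : ∀ {a} L {R} → Distinct (a ∷ L ++ R) → Distinct L
Distinct-∷-++⇒Distinctˡ L d = Distinct-++ˡ L (Distinct-shift L d)

Distinct-∷-++⇒Distinctʳ : ∀ {a} L {R} → Distinct (a ∷ L ++ R) → Distinct (a ∷ R)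
Distinct-∷-++⇒Distinctʳ L d = Distinct-++ʳ L (Distinct-shift L d)

Distinct-∷-++⇒Disjoint : ∀ {a} L {R} → Distinct (a ∷ L ++ R) → Disjoint L (a ∷ R)
Distinct-∷-++⇒Disjoint L d = Distinct-++⇒Disjoint L (Distinct-shift L d)

Disjoint-∌ : ∀ {u v} x → Disjoint u v → 0 < occ x u → 0 < occ x v → ⊥
Disjoint-∌ x d x∈u x∈v with occ≡0 d x
... | inj₁ x∉u = <-irrefl (sym x∉u) x∈u
... | inj₂ x∉v = <-irrefl (sym x∉v) x∈v

Disjoint-supp : ∀ {L M u v} → (∀ x → occ x L ≡ 0 → occ x u ≡ 0) → (∀ x → occ x M ≡ 0 → occ x v ≡ 0) →
                Disjoint L M → Disjoint u v
Disjoint-supp u⊆L v⊆M d = disjoint λ x → Sum.map (u⊆L x) (v⊆M x) (occ≡0 d x)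

AvoidsAbab : List ℕ → Set
AvoidsAbab w = ∀ a b → a ∷ b ∷ a ∷ b ∷ [] ⊆ w → a ≡ b

AvoidsAbab-⊆ : ∀ {v w} → v ⊆ w → AvoidsAbab w → AvoidsAbab v
AvoidsAbab-⊆ v⊆w av a b τ = av a b (⊆-trans τ v⊆w)

AvoidsAbab-singleton : ∀ a → AvoidsAbab [ a ]
AvoidsAbab-singleton a x y (a ∷ʳ ())
AvoidsAbab-singleton a x y (_ ∷ ())

∷⊆⇒occ>0 : ∀ {x xs w} → x ∷ xs ⊆ w → 0 < occ x w
∷⊆⇒occ>0 {x} (y ∷ʳ τ) = ≤-trans (∷⊆⇒occ>0 τ) (m≤n+m _ (δ x y))
∷⊆⇒occ>0 {x} {xs} {_ ∷ w} (refl ∷ τ) = subst (0 <_) (sym (occ-head x w)) (s≤s z≤n)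

occ>0⇒[x]⊆ : ∀ {x w} → 0 < occ x w → [ x ] ⊆ w
occ>0⇒[x]⊆ {x} {w} x∈w with occ-split x w x∈w
... | p , q , refl , _ = ++⁺ˡ p (refl ∷ minimum q)

⊆-++⁻ : ∀ (u : List ℕ) {v xs : List ℕ} → xs ⊆ u ++ v → ∃₂ λ xs₁ xs₂ → xs₁ ++ xs₂ ≡ xs × xs₁ ⊆ u × xs₂ ⊆ v
⊆-++⁻ []      τ         = [] , _ , refl , [] , τ
⊆-++⁻ (y ∷ u) (.y ∷ʳ τ) with ⊆-++⁻ u τ
... | xs₁ , xs₂ , refl , τ₁ , τ₂ = xs₁ , xs₂ , refl , y ∷ʳ τ₁ , τ₂
⊆-++⁻ (y ∷ u) (refl ∷ τ) with ⊆-++⁻ u τ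
... | xs₁ , xs₂ , refl , τ₁ , τ₂ = y ∷ xs₁ , xs₂ , refl , refl ∷ τ₁ , τ₂

AvoidsAbab-++ : ∀ u v → Disjoint u v → AvoidsAbab u → AvoidsAbab v → AvoidsAbab (u ++ v)
AvoidsAbab-++ u v d avu avv a b τ with ⊆-++⁻ u {v} τ
... | []                     , _  , refl , τ₁ , τ₂ = avv a b τ₂
... | _ ∷ []                 , _  , refl , τ₁ , τ₂ = ⊥-elim (Disjoint-∌ a d (∷⊆⇒occ>0 τ₁) (∷⊆⇒occ>0 (⊆-trans (b ∷ʳ ⊆-refl) τ₂)))
... | _ ∷ _ ∷ []             , _  , refl , τ₁ , τ₂ = ⊥-elim (Disjoint-∌ a d (∷⊆⇒occ>0 τ₁) (∷⊆⇒occ>0 τ₂))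
... | _ ∷ _ ∷ _ ∷ []         , _  , refl , τ₁ , τ₂ = ⊥-elim (Disjoint-∌ b d (∷⊆⇒occ>0 (⊆-trans (a ∷ʳ ⊆-refl) τ₁)) (∷⊆⇒occ>0 τ₂))
... | _ ∷ _ ∷ _ ∷ _ ∷ []     , [] , refl , τ₁ , τ₂ = avu a b τ₁

AvoidsAbab-nest : ∀ a u v → occ a u ≡ 0 → Disjoint u (a ∷ v) → AvoidsAbab u → AvoidsAbab (a ∷ v) →
                   AvoidsAbab (a ∷ u ++ a ∷ v)
AvoidsAbab-nest a u v a∉u d avu avav x y (.a ∷ʳ τ) = AvoidsAbab-++ u (a ∷ v) d avu avav x y τ
AvoidsAbab-nest a u v a∉u d avu avav x y (refl ∷ τ) with ⊆-++⁻ u {a ∷ v} τ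
... | []             , _ , refl , _  , .a ∷ʳ τ₂  = avav a y (refl ∷ τ₂)
... | []             , _ , refl , _  , refl ∷ τ₂ = refl
... | _ ∷ []         , _ , refl , τ₁ , τ₂        = ⊥-elim (Disjoint-∌ y d (∷⊆⇒occ>0 τ₁) (∷⊆⇒occ>0 (⊆-trans (a ∷ʳ ⊆-refl) τ₂)))
... | _ ∷ _ ∷ []     , _ , refl , τ₁ , _         = ⊥-elim (<-irrefl (sym a∉u) (∷⊆⇒occ>0 (⊆-trans (y ∷ʳ ⊆-refl) τ₁)))
... | _ ∷ _ ∷ _ ∷ [] , _ , refl , τ₁ , _         = ⊥-elim (<-irrefl (sym a∉u) (∷⊆⇒occ>0 (⊆-trans (y ∷ʳ ⊆-refl) τ₁)))

AvoidsAbab-separates : ∀ a p q {x} → AvoidsAbab (a ∷ p ++ a ∷ q) → x ≢ a → occ x p ≡ 0 ⊎ occ x q ≡ 0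
AvoidsAbab-separates a p q {x} av x≢a with occ x p ≟ 0 | occ x q ≟ 0
... | yes x∉p | _        = inj₁ x∉p
... | _       | yes x∉q  = inj₂ x∉q
... | no x∈p  | no x∈q   =
  ⊥-elim (x≢a (sym (av a x (refl ∷ ++⁺ (occ>0⇒[x]⊆ (n≢0⇒n>0 x∈p)) (refl ∷ occ>0⇒[x]⊆ (n≢0⇒n>0 x∈q))))))

position : ∀ {xs ys : List ℕ} → xs ⊆ ys → Fin (length xs) → Fin (length ys)
position (y ∷ʳ τ) i      = fs (position τ i)
position (_ ∷ τ)  fz     = fz
position (_ ∷ τ)  (fs i) = fs (position τ i)

lookup-position : ∀ {xs ys : List ℕ} (τ : xs ⊆ ys) i → lookup ys (position τ i) ≡ lookup xs i
lookup-position (y ∷ʳ τ)   i      = lookup-position τ i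
lookup-position (refl ∷ τ) fz     = refl
lookup-position (refl ∷ τ) (fs i) = lookup-position τ i

position-mono : ∀ {xs ys : List ℕ} (τ : xs ⊆ ys) {i j} → i <F j → position τ i <F position τ j
position-mono (y ∷ʳ τ) i<j                   = s≤s (position-mono τ i<j)
position-mono (_ ∷ τ)  {fz}   {fs j} _       = s≤s z≤n
position-mono (_ ∷ τ)  {fs i} {fs j} (s≤s i<j) = s≤s (position-mono τ i<j)

Avoids1212⇒AvoidsAbab : ∀ π → Avoids1212 π → AvoidsAbab π
Avoids1212⇒AvoidsAbab π av a b τ = begin
  a                         ≡⟨ at i₀ ⟨
  lookup π (position τ i₀)  ≡⟨ av (position τ i₀) (position τ i₁) (position τ i₂) (position τ i₃)
                                  (position-mono τ (s≤s z≤n)) (position-mono τ (s≤s (s≤s z≤n)))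
                                  (position-mono τ (s≤s (s≤s (s≤s z≤n))))
                                  (trans (at i₀) (sym (at i₂))) (trans (at i₁) (sym (at i₃))) ⟩
  lookup π (position τ i₁)  ≡⟨ at i₁ ⟩
  b                         ∎
  where
  open ≡-Reasoning
  at : ∀ i → lookup π (position τ i) ≡ lookup (a ∷ b ∷ a ∷ b ∷ []) i
  at = lookup-position τ
  i₀ i₁ i₂ i₃ : Fin 4
  i₀ = fz
  i₁ = fs fz
  i₂ = fs (fs fz)
  i₃ = fs (fs (fs fz))

lookup₁⊆ : ∀ (π : List ℕ) (i : Fin (length π)) → [ lookup π i ] ⊆ π
lookup₁⊆ (x ∷ π) fz     = refl ∷ minimum π
lookup₁⊆ (x ∷ π) (fs i) = x ∷ʳ lookup₁⊆ π i

lookup₂⊆ : ∀ (π : List ℕ) (i j : Fin (length π)) → i <F j → lookup π i ∷ lookup π j ∷ [] ⊆ π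
lookup₂⊆ (x ∷ π) fz     (fs j) _         = refl ∷ lookup₁⊆ π j
lookup₂⊆ (x ∷ π) (fs i) (fs j) (s≤s i<j) = x ∷ʳ lookup₂⊆ π i j i<j

lookup₃⊆ : ∀ (π : List ℕ) (i j l : Fin (length π)) → i <F j → j <F l → lookup π i ∷ lookup π j ∷ lookup π l ∷ [] ⊆ π
lookup₃⊆ (x ∷ π) fz     (fs j) (fs l) _         j<l       = refl ∷ lookup₂⊆ π j l (≤-pred j<l)
lookup₃⊆ (x ∷ π) (fs i) (fs j) (fs l) (s≤s i<j) (s≤s j<l) = x ∷ʳ lookup₃⊆ π i j l i<j j<l

lookup₄⊆ : ∀ (π : List ℕ) (i j l m : Fin (length π)) → i <F j → j <F l → l <F m →
           lookup π i ∷ lookup π j ∷ lookup π l ∷ lookup π m ∷ [] ⊆ π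
lookup₄⊆ (x ∷ π) fz     (fs j) (fs l) (fs m) _         j<l       l<m       = refl ∷ lookup₃⊆ π j l m (≤-pred j<l) (≤-pred l<m)
lookup₄⊆ (x ∷ π) (fs i) (fs j) (fs l) (fs m) (s≤s i<j) (s≤s j<l) (s≤s l<m) = x ∷ʳ lookup₄⊆ π i j l m i<j j<l l<m

AvoidsAbab⇒Avoids1212 : ∀ π → AvoidsAbab π → Avoids1212 π
AvoidsAbab⇒Avoids1212 π av i j l m i<j j<l l<m πi≡πl πj≡πm =
  av (lookup π i) (lookup π j) (subst₂ (λ πl πm → lookup π i ∷ lookup π j ∷ πl ∷ πm ∷ [] ⊆ π)
                                       (sym πi≡πl) (sym πj≡πm) (lookup₄⊆ π i j l m i<j j<l l<m))

adjFrom : (ℕ → ℕ → Bool) → ℕ → List ℕ → ℕ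
adjFrom f p []      = 0
adjFrom f p (y ∷ w) = ind (f p y) + adjFrom f y w

adj : (ℕ → ℕ → Bool) → List ℕ → ℕ
adj f []      = 0
adj f (x ∷ w) = adjFrom f x w

cyclicAdj : (ℕ → ℕ → Bool) → List ℕ → ℕ
cyclicAdj f []      = 0
cyclicAdj f (x ∷ w) = adjFrom f x (w ++ [ x ])

adjFrom-++ : ∀ f p u b w → adjFrom f p (u ++ b ∷ w) ≡ adjFrom f p (u ++ [ b ]) + adjFrom f b w
adjFrom-++ f p []      b w = cong (_+ adjFrom f b w) (sym (+-identityʳ _))
adjFrom-++ f p (y ∷ u) b w = trans (cong (ind (f p y) +_) (adjFrom-++ f y u b w)) (sym (+-assoc (ind (f p y)) _ _))

nasc≡adj : ∀ w → nasc w ≡ adj _<ᵇ_ w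
nasc≡adj []          = refl
nasc≡adj (x ∷ [])    = refl
nasc≡adj (x ∷ y ∷ w) = cong (ind (x <ᵇ y) +_) (nasc≡adj (y ∷ w))

ndes≡adj : ∀ w → ndes w ≡ adj (flip _<ᵇ_) w
ndes≡adj []          = refl
ndes≡adj (x ∷ [])    = refl
ndes≡adj (x ∷ y ∷ w) = cong (ind (y <ᵇ x) +_) (ndes≡adj (y ∷ w))

nplat≡adj : ∀ w → nplat w ≡ adj _≡ᵇ_ w
nplat≡adj []          = refl
nplat≡adj (x ∷ [])    = refl
nplat≡adj (x ∷ y ∷ w) = cong (δ x y +_) (nplat≡adj (y ∷ w))

casc≡cyclicAdj : ∀ w → casc w ≡ cyclicAdj _<ᵇ_ w
casc≡cyclicAdj []      = refl
casc≡cyclicAdj (x ∷ w) = nasc≡adj (x ∷ w ++ [ x ])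

cdes≡cyclicAdj : ∀ w → cdes w ≡ cyclicAdj (flip _<ᵇ_) w
cdes≡cyclicAdj []      = refl
cdes≡cyclicAdj (x ∷ w) = ndes≡adj (x ∷ w ++ [ x ])

Distinct⇒adjFrom≡ᵇ≡0 : ∀ p w → Distinct (p ∷ w) → adjFrom _≡ᵇ_ p w ≡ 0
Distinct⇒adjFrom≡ᵇ≡0 p []      _ = refl
Distinct⇒adjFrom≡ᵇ≡0 p (y ∷ w) d =
  cong₂ _+_ (m+n≡0⇒m≡0 (δ p y) (Distinct-head d)) (Distinct⇒adjFrom≡ᵇ≡0 y w (Distinct-tail d))

Distinct⇒adj≡ᵇ≡0 : ∀ w → Distinct w → adj _≡ᵇ_ w ≡ 0
Distinct⇒adj≡ᵇ≡0 []      _ = refl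
Distinct⇒adj≡ᵇ≡0 (x ∷ w) d = Distinct⇒adjFrom≡ᵇ≡0 x w d

Distinct⇒cyclicAdj≡ᵇ≡0 : ∀ x y w → Distinct (x ∷ y ∷ w) → cyclicAdj _≡ᵇ_ (x ∷ y ∷ w) ≡ 0
Distinct⇒cyclicAdj≡ᵇ≡0 x y w d = cong₂ _+_ (m+n≡0⇒m≡0 (δ x y) (Distinct-head d))
  (Distinct⇒adjFrom≡ᵇ≡0 y (w ++ [ x ]) (Distinct-resp-↭ (∷↭∷ʳ x (y ∷ w)) d))

-- h = k − 2 half-edges per vertex, so that Vec _ (k ∸ 1) is Vec _ (suc h).
module Walk (h : ℕ) where

  k : ℕ
  k = suc (suc h)

  Edges : Set
  Edges = List (ℕ × NTree k)

  edgeWord : ∀ {j} → ℕ → Vec Edges (suc j) → List ℕ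
  edgeWord a cs = a ∷ φC a cs ++ [ a ]

  φE-∷ : ∀ a (cs : Vec Edges (suc h)) es → φE ((a , node cs) ∷ es) ≡ edgeWord a cs ++ φE es
  φE-∷ a cs es = cong (a ∷_) (sym (++-assoc (φC a cs) [ a ] (φE es)))

  mutual
    occ-φE : ∀ x (es : Edges) → occ x (φE es) ≡ k * occ x (labelsE es)
    occ-φE x [] = sym (*-zeroʳ k)
    occ-φE x ((a , node cs) ∷ es) = begin
      δ x a + occ x (φC a cs ++ a ∷ φE es)
        ≡⟨ cong (δ x a +_) (occ-++ x (φC a cs) (a ∷ φE es)) ⟩
      δ x a + (occ x (φC a cs) + (δ x a + occ x (φE es)))
        ≡⟨ cong₂ (λ m n → δ x a + (m + (δ x a + n))) (occ-φC x a cs) (occ-φE x es) ⟩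
      δ x a + ((h * δ x a + k * occ x (labelsC cs)) + (δ x a + k * occ x (labelsE es)))
        ≡⟨ rearrange h (δ x a) (occ x (labelsC cs)) (occ x (labelsE es)) ⟩
      k * (δ x a + (occ x (labelsC cs) + occ x (labelsE es)))
        ≡⟨ cong (λ n → k * (δ x a + n)) (occ-++ x (labelsC cs) (labelsE es)) ⟨
      k * occ x (labelsE ((a , node cs) ∷ es)) ∎
      where
      open ≡-Reasoning
      rearrange : ∀ h d C E → d + ((h * d + suc (suc h) * C) + (d + suc (suc h) * E)) ≡ suc (suc h) * (d + (C + E))
      rearrange = solve-∀

    occ-φC : ∀ x a {j} (cs : Vec Edges (suc j)) → occ x (φC a cs) ≡ j * δ x a + k * occ x (labelsC cs)
    occ-φC x a (c ∷v []v) rewrite ++-identityʳ (labelsE c) = occ-φE x c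
    occ-φC x a {suc j} (c ∷v d ∷v cs) = begin
      occ x (φE c ++ a ∷ φC a (d ∷v cs))
        ≡⟨ occ-++ x (φE c) _ ⟩
      occ x (φE c) + (δ x a + occ x (φC a (d ∷v cs)))
        ≡⟨ cong₂ (λ m n → m + (δ x a + n)) (occ-φE x c) (occ-φC x a (d ∷v cs)) ⟩
      k * occ x (labelsE c) + (δ x a + (j * δ x a + k * occ x (labelsC (d ∷v cs))))
        ≡⟨ rearrange h j (δ x a) (occ x (labelsE c)) (occ x (labelsC (d ∷v cs))) ⟩
      suc j * δ x a + k * (occ x (labelsE c) + occ x (labelsC (d ∷v cs)))
        ≡⟨ cong (λ n → suc j * δ x a + k * n) (occ-++ x (labelsE c) _) ⟨
      suc j * δ x a + k * occ x (labelsC (c ∷v d ∷v cs)) ∎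
      where
      open ≡-Reasoning
      rearrange : ∀ h j d C R → suc (suc h) * C + (d + (j * d + suc (suc h) * R)) ≡ suc j * d + suc (suc h) * (C + R)
      rearrange = solve-∀

  occ-φE-0 : ∀ {x} (es : Edges) → occ x (labelsE es) ≡ 0 → occ x (φE es) ≡ 0
  occ-φE-0 {x} es x∉es = trans (occ-φE x es) (trans (cong (k *_) x∉es) (*-zeroʳ k))

  occ-edgeWord-0 : ∀ {x a j} (cs : Vec Edges (suc j)) → occ x (a ∷ labelsC cs) ≡ 0 → occ x (edgeWord a cs) ≡ 0
  occ-edgeWord-0 {x} {a} {j} cs x∉
    rewrite occ-++ x (φC a cs) [ a ] | occ-φC x a cs
          | m+n≡0⇒m≡0 (δ x a) x∉ | m+n≡0⇒n≡0 (δ x a) x∉ | *-zeroʳ j | *-zeroʳ k = refl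

  mutual
    φE-avoids : ∀ (es : Edges) → Distinct (labelsE es) → AvoidsAbab (φE es)
    φE-avoids []                   _ a b ()
    φE-avoids ((a , node cs) ∷ es) d = subst AvoidsAbab (sym (φE-∷ a cs es))
      (AvoidsAbab-++ (edgeWord a cs) (φE es)
        (Disjoint-supp (λ _ → occ-edgeWord-0 cs) (λ _ → occ-φE-0 es) (Distinct-++⇒Disjoint (a ∷ labelsC cs) d))
        (edgeWord-avoids a cs (Distinct-++ˡ (a ∷ labelsC cs) d))
        (φE-avoids es (Distinct-++ʳ (a ∷ labelsC cs) d)))

    edgeWord-avoids : ∀ a {j} (cs : Vec Edges (suc j)) → Distinct (a ∷ labelsC cs) → AvoidsAbab (edgeWord a cs)
    edgeWord-avoids a (c ∷v []v) d =
      AvoidsAbab-nest a (φE c) [] (occ-φE-0 c (Distinct-∷-++⇒∉ (labelsE c) d))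
        (Disjoint-supp (λ _ → occ-φE-0 c) (λ _ a∉ → a∉) (Distinct-∷-++⇒Disjoint (labelsE c) d))
        (φE-avoids c (Distinct-∷-++⇒Distinctˡ (labelsE c) d))
        (AvoidsAbab-singleton a)
    edgeWord-avoids a (c ∷v e ∷v cs) d = subst AvoidsAbab (cong (a ∷_) (sym (++-assoc (φE c) _ [ a ])))
      (AvoidsAbab-nest a (φE c) (φC a (e ∷v cs) ++ [ a ]) (occ-φE-0 c (Distinct-∷-++⇒∉ (labelsE c) d))
        (Disjoint-supp (λ _ → occ-φE-0 c) (λ _ → occ-edgeWord-0 (e ∷v cs)) (Distinct-∷-++⇒Disjoint (labelsE c) d))
        (φE-avoids c (Distinct-∷-++⇒Distinctˡ (labelsE c) d))
        (edgeWord-avoids a (e ∷v cs) (Distinct-∷-++⇒Distinctʳ (labelsE c) d)))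

  mutual
    vertexAdj : (ℕ → ℕ → Bool) → Edges → ℕ
    vertexAdj f []                   = 0
    vertexAdj f ((a , node cs) ∷ es) = (cyclicAdj f (vword a cs) + vertexAdjC f cs) + vertexAdj f es

    vertexAdjC : ∀ {m} → (ℕ → ℕ → Bool) → Vec Edges m → ℕ
    vertexAdjC f []v       = 0
    vertexAdjC f (c ∷v cs) = vertexAdj f c + vertexAdjC f cs

  mutual
    adjFrom-φE : ∀ f p (es : Edges) r →
                 adjFrom f p (φE es ++ r) ≡ adjFrom f p (map proj₁ es ++ r) + vertexAdj f es
    adjFrom-φE f p [] r = sym (+-identityʳ _)
    adjFrom-φE f p ((a , node cs) ∷ es) r = begin
      ind (f p a) + adjFrom f a ((φC a cs ++ a ∷ φE es) ++ r)
        ≡⟨ cong (λ w → ind (f p a) + adjFrom f a w) (++-assoc (φC a cs) (a ∷ φE es) r) ⟩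
      ind (f p a) + adjFrom f a (φC a cs ++ a ∷ (φE es ++ r))
        ≡⟨ cong (ind (f p a) +_) (adjFrom-φC f a cs (φE es ++ r)) ⟩
      ind (f p a) + (V + adjFrom f a (φE es ++ r))
        ≡⟨ cong (λ n → ind (f p a) + (V + n)) (adjFrom-φE f a es r) ⟩
      ind (f p a) + (V + (adjFrom f a (map proj₁ es ++ r) + vertexAdj f es))
        ≡⟨ rearrange (ind (f p a)) V (adjFrom f a (map proj₁ es ++ r)) (vertexAdj f es) ⟩
      ind (f p a) + adjFrom f a (map proj₁ es ++ r) + (V + vertexAdj f es) ∎
      where
      open ≡-Reasoning
      V : ℕ
      V = cyclicAdj f (vword a cs) + vertexAdjC f cs
      rearrange : ∀ i V P E → i + (V + (P + E)) ≡ i + P + (V + E)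
      rearrange = solve-∀

    adjFrom-φC : ∀ f a {j} (cs : Vec Edges (suc j)) w →
                 adjFrom f a (φC a cs ++ a ∷ w) ≡ (cyclicAdj f (vword a cs) + vertexAdjC f cs) + adjFrom f a w
    adjFrom-φC f a (c ∷v []v) w = begin
      adjFrom f a (φE c ++ a ∷ w)
        ≡⟨ adjFrom-φE f a c (a ∷ w) ⟩
      adjFrom f a (map proj₁ c ++ a ∷ w) + vertexAdj f c
        ≡⟨ cong (_+ vertexAdj f c) (adjFrom-++ f a (map proj₁ c) a w) ⟩
      adjFrom f a (map proj₁ c ++ [ a ]) + adjFrom f a w + vertexAdj f c
        ≡⟨ cong (λ u → adjFrom f a (u ++ [ a ]) + adjFrom f a w + vertexAdj f c) (++-identityʳ (map proj₁ c)) ⟨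
      adjFrom f a ((map proj₁ c ++ []) ++ [ a ]) + adjFrom f a w + vertexAdj f c
        ≡⟨ rearrange _ (adjFrom f a w) (vertexAdj f c) ⟩
      adjFrom f a ((map proj₁ c ++ []) ++ [ a ]) + (vertexAdj f c + 0) + adjFrom f a w ∎
      where
      open ≡-Reasoning
      rearrange : ∀ A B E → A + B + E ≡ A + (E + 0) + B
      rearrange = solve-∀
    adjFrom-φC f a (c ∷v d ∷v cs) w = begin
      adjFrom f a ((φE c ++ a ∷ φC a (d ∷v cs)) ++ a ∷ w)
        ≡⟨ cong (adjFrom f a) (++-assoc (φE c) (a ∷ φC a (d ∷v cs)) (a ∷ w)) ⟩
      adjFrom f a (φE c ++ a ∷ (φC a (d ∷v cs) ++ a ∷ w))
        ≡⟨ adjFrom-φE f a c _ ⟩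
      adjFrom f a (map proj₁ c ++ a ∷ (φC a (d ∷v cs) ++ a ∷ w)) + vertexAdj f c
        ≡⟨ cong (_+ vertexAdj f c) (adjFrom-++ f a (map proj₁ c) a _) ⟩
      adjFrom f a (map proj₁ c ++ [ a ]) + adjFrom f a (φC a (d ∷v cs) ++ a ∷ w) + vertexAdj f c
        ≡⟨ cong (λ n → adjFrom f a (map proj₁ c ++ [ a ]) + n + vertexAdj f c) (adjFrom-φC f a (d ∷v cs) w) ⟩
      adjFrom f a (map proj₁ c ++ [ a ]) + (adjFrom f a Y + vertexAdjC f (d ∷v cs) + adjFrom f a w) + vertexAdj f c
        ≡⟨ rearrange (adjFrom f a (map proj₁ c ++ [ a ])) (adjFrom f a w) (adjFrom f a Y) (vertexAdjC f (d ∷v cs)) (vertexAdj f c) ⟩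
      adjFrom f a (map proj₁ c ++ [ a ]) + adjFrom f a Y + (vertexAdj f c + vertexAdjC f (d ∷v cs)) + adjFrom f a w
        ≡⟨ cong (λ n → n + (vertexAdj f c + vertexAdjC f (d ∷v cs)) + adjFrom f a w) (adjFrom-++ f a (map proj₁ c) a Y) ⟨
      adjFrom f a (map proj₁ c ++ a ∷ Y) + (vertexAdj f c + vertexAdjC f (d ∷v cs)) + adjFrom f a w
        ≡⟨ cong (λ u → adjFrom f a u + (vertexAdj f c + vertexAdjC f (d ∷v cs)) + adjFrom f a w)
                (++-assoc (map proj₁ c) (vword a (d ∷v cs)) [ a ]) ⟨
      adjFrom f a ((map proj₁ c ++ vword a (d ∷v cs)) ++ [ a ]) + (vertexAdj f c + vertexAdjC f (d ∷v cs)) + adjFrom f a w ∎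
      where
      open ≡-Reasoning
      Y : List ℕ
      Y = (map proj₁ d ++ vword a cs) ++ [ a ]
      rearrange : ∀ A B P S Q → A + (P + S + B) + Q ≡ A + P + (Q + S) + B
      rearrange = solve-∀

  adj-φE : ∀ f (es : Edges) → adj f (φE es) ≡ adj f (map proj₁ es) + vertexAdj f es
  adj-φE f [] = refl
  adj-φE f ((a , node cs) ∷ es) = begin
    adjFrom f a (φC a cs ++ a ∷ φE es)
      ≡⟨ adjFrom-φC f a cs (φE es) ⟩
    V + adjFrom f a (φE es)
      ≡⟨ cong (λ w → V + adjFrom f a w) (++-identityʳ (φE es)) ⟨
    V + adjFrom f a (φE es ++ [])
      ≡⟨ cong (V +_) (adjFrom-φE f a es []) ⟩
    V + (adjFrom f a (map proj₁ es ++ []) + vertexAdj f es)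
      ≡⟨ cong (λ w → V + (adjFrom f a w + vertexAdj f es)) (++-identityʳ (map proj₁ es)) ⟩
    V + (adjFrom f a (map proj₁ es) + vertexAdj f es)
      ≡⟨ x∙yz≈y∙xz V (adjFrom f a (map proj₁ es)) (vertexAdj f es) ⟩
    adjFrom f a (map proj₁ es) + (V + vertexAdj f es) ∎
    where
    open ≡-Reasoning
    V : ℕ
    V = cyclicAdj f (vword a cs) + vertexAdjC f cs

  mutual
    vertexAdj-casc : ∀ (es : Edges) → vertexAdj _<ᵇ_ es ≡ cascE es
    vertexAdj-casc []                   = refl
    vertexAdj-casc ((a , node cs) ∷ es) =
      cong₂ _+_ (cong₂ _+_ (sym (casc≡cyclicAdj (vword a cs))) (vertexAdjC-casc cs)) (vertexAdj-casc es)

    vertexAdjC-casc : ∀ {m} (cs : Vec Edges m) → vertexAdjC _<ᵇ_ cs ≡ cascC cs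
    vertexAdjC-casc []v       = refl
    vertexAdjC-casc (c ∷v cs) = cong₂ _+_ (vertexAdj-casc c) (vertexAdjC-casc cs)

  mutual
    vertexAdj-cdes : ∀ (es : Edges) → vertexAdj (flip _<ᵇ_) es ≡ cdesE es
    vertexAdj-cdes []                   = refl
    vertexAdj-cdes ((a , node cs) ∷ es) =
      cong₂ _+_ (cong₂ _+_ (sym (cdes≡cyclicAdj (vword a cs))) (vertexAdjC-cdes cs)) (vertexAdj-cdes es)

    vertexAdjC-cdes : ∀ {m} (cs : Vec Edges m) → vertexAdjC (flip _<ᵇ_) cs ≡ cdesC cs
    vertexAdjC-cdes []v       = refl
    vertexAdjC-cdes (c ∷v cs) = cong₂ _+_ (vertexAdj-cdes c) (vertexAdjC-cdes cs)

  asc-φ : ∀ (T : Edges) → asc (φE T) ≡ asc (map proj₁ T) + cascE T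
  asc-φ []                     = refl
  asc-φ T@((a , node cs) ∷ es) = cong suc (begin
    nasc (φE T)                                 ≡⟨ nasc≡adj (φE T) ⟩
    adj _<ᵇ_ (φE T)                             ≡⟨ adj-φE _<ᵇ_ T ⟩
    adj _<ᵇ_ (map proj₁ T) + vertexAdj _<ᵇ_ T   ≡⟨ cong₂ _+_ (sym (nasc≡adj (map proj₁ T))) (vertexAdj-casc T) ⟩
    nasc (map proj₁ T) + cascE T                ∎)
    where open ≡-Reasoning

  des-φ : ∀ (T : Edges) → des (φE T) ≡ des (map proj₁ T) + cdesE T
  des-φ []                     = refl
  des-φ T@((a , node cs) ∷ es) = cong suc (begin
    ndes (φE T)                                               ≡⟨ ndes≡adj (φE T) ⟩
    adj (flip _<ᵇ_) (φE T)                                    ≡⟨ adj-φE (flip _<ᵇ_) T ⟩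
    adj (flip _<ᵇ_) (map proj₁ T) + vertexAdj (flip _<ᵇ_) T   ≡⟨ cong₂ _+_ (sym (ndes≡adj (map proj₁ T))) (vertexAdj-cdes T) ⟩
    ndes (map proj₁ T) + cdesE T                              ∎)
    where open ≡-Reasoning

  occ-roots≤occ-labels : ∀ x (es : Edges) → occ x (map proj₁ es) ≤ occ x (labelsE es)
  occ-roots≤occ-labels x []             = z≤n
  occ-roots≤occ-labels x ((a , t) ∷ es) = +-monoʳ-≤ (δ x a) (begin
    occ x (map proj₁ es)                ≤⟨ occ-roots≤occ-labels x es ⟩
    occ x (labelsE es)                  ≤⟨ m≤n+m _ _ ⟩
    occ x (labelsV t) + occ x (labelsE es) ≡⟨ occ-++ x (labelsV t) (labelsE es) ⟨
    occ x (labelsV t ++ labelsE es)     ∎)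
    where open ≤-Reasoning

  cyclicAdj-vword-∷ : ∀ f a c {m} (cs : Vec Edges m) →
    cyclicAdj f (vword a (c ∷v cs)) ≡ cyclicAdj f (a ∷ map proj₁ c) + cyclicAdj f (vword a cs)
  cyclicAdj-vword-∷ f a c []v =
    trans (cong (λ u → adjFrom f a (u ++ [ a ])) (++-identityʳ (map proj₁ c))) (sym (+-identityʳ _))
  cyclicAdj-vword-∷ f a c (d ∷v cs) =
    trans (cong (adjFrom f a) (++-assoc (map proj₁ c) (a ∷ map proj₁ d ++ vword a cs) [ a ]))
          (adjFrom-++ f a (map proj₁ c) a _)

  mutual
    vertexAdj-emp : ∀ (es : Edges) → Distinct (labelsE es) → vertexAdj _≡ᵇ_ es ≡ empE es
    vertexAdj-emp []                   _ = refl
    vertexAdj-emp ((a , node cs) ∷ es) d =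
      cong₂ _+_ (vertex-emp a cs (Distinct-++ˡ (a ∷ labelsC cs) d)) (vertexAdj-emp es (Distinct-++ʳ (a ∷ labelsC cs) d))

    vertex-emp : ∀ a {m} (cs : Vec Edges m) → Distinct (a ∷ labelsC cs) →
                 cyclicAdj _≡ᵇ_ (vword a cs) + vertexAdjC _≡ᵇ_ cs ≡ empC cs
    vertex-emp a []v _ = refl
    vertex-emp a ([] ∷v cs) d = begin
      cyclicAdj _≡ᵇ_ (vword a ([] ∷v cs)) + (0 + vertexAdjC _≡ᵇ_ cs)
        ≡⟨ cong (_+ vertexAdjC _≡ᵇ_ cs) (cyclicAdj-vword-∷ _≡ᵇ_ a [] cs) ⟩
      (δ a a + 0) + cyclicAdj _≡ᵇ_ (vword a cs) + vertexAdjC _≡ᵇ_ cs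
        ≡⟨ cong (λ n → n + 0 + cyclicAdj _≡ᵇ_ (vword a cs) + vertexAdjC _≡ᵇ_ cs) (δ-refl a) ⟩
      suc (cyclicAdj _≡ᵇ_ (vword a cs) + vertexAdjC _≡ᵇ_ cs)
        ≡⟨ cong suc (vertex-emp a cs d) ⟩
      suc (empC cs) ∎
      where open ≡-Reasoning
    vertex-emp a (c@(e ∷ c′) ∷v cs) d = begin
      cyclicAdj _≡ᵇ_ (vword a (c ∷v cs)) + (vertexAdj _≡ᵇ_ c + vertexAdjC _≡ᵇ_ cs)
        ≡⟨ cong (_+ (vertexAdj _≡ᵇ_ c + vertexAdjC _≡ᵇ_ cs)) (cyclicAdj-vword-∷ _≡ᵇ_ a c cs) ⟩
      cyclicAdj _≡ᵇ_ (a ∷ map proj₁ c) + cyclicAdj _≡ᵇ_ (vword a cs) + (vertexAdj _≡ᵇ_ c + vertexAdjC _≡ᵇ_ cs)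
        ≡⟨ cong (λ n → n + cyclicAdj _≡ᵇ_ (vword a cs) + (vertexAdj _≡ᵇ_ c + vertexAdjC _≡ᵇ_ cs))
                (Distinct⇒cyclicAdj≡ᵇ≡0 a (proj₁ e) (map proj₁ c′) (Distinct-occ-mono roots≤labels d)) ⟩
      cyclicAdj _≡ᵇ_ (vword a cs) + (vertexAdj _≡ᵇ_ c + vertexAdjC _≡ᵇ_ cs)
        ≡⟨ x∙yz≈y∙xz (cyclicAdj _≡ᵇ_ (vword a cs)) (vertexAdj _≡ᵇ_ c) (vertexAdjC _≡ᵇ_ cs) ⟩
      vertexAdj _≡ᵇ_ c + (cyclicAdj _≡ᵇ_ (vword a cs) + vertexAdjC _≡ᵇ_ cs)
        ≡⟨ cong₂ _+_ (vertexAdj-emp c (Distinct-∷-++⇒Distinctˡ (labelsE c) d)) (vertex-emp a cs (Distinct-∷-++⇒Distinctʳ (labelsE c) d)) ⟩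
      empE c + empC cs ∎
      where
      open ≡-Reasoning
      roots≤labels : ∀ x → occ x (a ∷ map proj₁ c) ≤ occ x (a ∷ labelsE c ++ labelsC cs)
      roots≤labels x = +-monoʳ-≤ (δ x a) (≤-trans (occ-roots≤occ-labels x c)
                         (≤-trans (m≤m+n _ _) (≤-reflexive (sym (occ-++ x (labelsE c) (labelsC cs))))))

  plat-φ : ∀ (T : Edges) → Distinct (labelsE T) → plat (φE T) ≡ empE T
  plat-φ T d = begin
    nplat (φE T)                                   ≡⟨ nplat≡adj (φE T) ⟩
    adj _≡ᵇ_ (φE T)                                ≡⟨ adj-φE _≡ᵇ_ T ⟩
    adj _≡ᵇ_ (map proj₁ T) + vertexAdj _≡ᵇ_ T      ≡⟨ cong₂ _+_ (Distinct⇒adj≡ᵇ≡0 (map proj₁ T) (Distinct-occ-mono (λ x → occ-roots≤occ-labels x T) d))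
                                                                (vertexAdj-emp T d) ⟩
    empE T                                         ∎
    where open ≡-Reasoning

  mutual
    φE-injective : ∀ (es es′ : Edges) → Distinct (labelsE es) → Distinct (labelsE es′) → φE es ≡ φE es′ → es ≡ es′
    φE-injective []                   []                     _ _  _  = refl
    φE-injective []                   ((a′ , node cs′) ∷ _)  _ _  ()
    φE-injective ((a , node cs) ∷ _)  []                     _ _  ()
    φE-injective ((a , node cs) ∷ es) ((a′ , node cs′) ∷ es′) d d′ eq =
      φE-∷-injective (proj₁ (∷-injective eq)) cs cs′ es es′ d d′ (proj₂ (∷-injective eq))

    φE-∷-injective : ∀ {a a′} → a ≡ a′ → ∀ (cs cs′ : Vec Edges (suc h)) es es′ →
                     Distinct (labelsE ((a , node cs) ∷ es)) → Distinct (labelsE ((a′ , node cs′) ∷ es′)) →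
                     φC a cs ++ a ∷ φE es ≡ φC a′ cs′ ++ a′ ∷ φE es′ → (a , node cs) ∷ es ≡ (a′ , node cs′) ∷ es′
    φE-∷-injective {a} refl cs cs′ es es′ d d′ eq =
      let cs≡cs′ , φes≡φes′ = φC-injective a cs cs′ (φE es) (φE es′)
                                 (Distinct-++ˡ (a ∷ labelsC cs) d) (Distinct-++ˡ (a ∷ labelsC cs′) d′) eq
      in cong₂ (λ cs es → (a , node cs) ∷ es) cs≡cs′
               (φE-injective es es′ (Distinct-++ʳ (a ∷ labelsC cs) d) (Distinct-++ʳ (a ∷ labelsC cs′) d′) φes≡φes′)

    φC-injective : ∀ a {j} (cs cs′ : Vec Edges (suc j)) w w′ → Distinct (a ∷ labelsC cs) → Distinct (a ∷ labelsC cs′) →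
                   φC a cs ++ a ∷ w ≡ φC a cs′ ++ a ∷ w′ → cs ≡ cs′ × w ≡ w′
    φC-injective a (c ∷v []v) (c′ ∷v []v) w w′ d d′ eq =
      let φc≡φc′ , w≡w′ = split-unique a (φE c) (φE c′) (occ-φE-0 c (Distinct-∷-++⇒∉ (labelsE c) d))
                                                       (occ-φE-0 c′ (Distinct-∷-++⇒∉ (labelsE c′) d′)) eq
      in cong (_∷v []v) (φE-injective c c′ (Distinct-∷-++⇒Distinctˡ (labelsE c) d)
                                           (Distinct-∷-++⇒Distinctˡ (labelsE c′) d′) φc≡φc′) ,
         w≡w′
    φC-injective a (c ∷v e ∷v cs) (c′ ∷v e′ ∷v cs′) w w′ d d′ eq =
      let φc≡φc′ , rest≡rest′ = split-unique a (φE c) (φE c′) (occ-φE-0 c (Distinct-∷-++⇒∉ (labelsE c) d))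
                                                             (occ-φE-0 c′ (Distinct-∷-++⇒∉ (labelsE c′) d′))
                                  (trans (sym (++-assoc (φE c) _ (a ∷ w))) (trans eq (++-assoc (φE c′) _ (a ∷ w′))))
          cs≡cs′ , w≡w′ = φC-injective a (e ∷v cs) (e′ ∷v cs′) w w′
                            (Distinct-∷-++⇒Distinctʳ (labelsE c) d)
                            (Distinct-∷-++⇒Distinctʳ (labelsE c′) d′) rest≡rest′
      in cong₂ _∷v_ (φE-injective c c′ (Distinct-∷-++⇒Distinctˡ (labelsE c) d)
                                       (Distinct-∷-++⇒Distinctˡ (labelsE c′) d′) φc≡φc′) cs≡cs′ ,
         w≡w′

  Balanced : List ℕ → Set
  Balanced w = ∀ x → occ x w ≡ 0 ⊎ occ x w ≡ k

  BalancedExcept : ℕ → List ℕ → Set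
  BalancedExcept a w = ∀ x → x ≢ a → occ x w ≡ 0 ⊎ occ x w ≡ k

  Balanced-∷⁻ : ∀ a w → Balanced (a ∷ w) → BalancedExcept a w
  Balanced-∷⁻ a w bal x x≢a = subst (λ n → n ≡ 0 ⊎ n ≡ k) (cong (_+ occ x w) (δ-≢ x≢a)) (bal x)

  BalancedExcept⇒Balanced : ∀ {a} w → occ a w ≡ 0 → BalancedExcept a w → Balanced w
  BalancedExcept⇒Balanced {a} w a∉w bal x with x ≟ a
  ... | yes refl = inj₁ a∉w
  ... | no x≢a   = bal x x≢a

  BalancedExcept-split : ∀ a p q → AvoidsAbab (a ∷ p ++ a ∷ q) → BalancedExcept a (p ++ a ∷ q) →
                         BalancedExcept a p × BalancedExcept a q
  BalancedExcept-split a p q av bal = balp , balq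
    where
    occ-v : ∀ {x} → x ≢ a → occ x (p ++ a ∷ q) ≡ occ x p + occ x q
    occ-v {x} x≢a = trans (occ-++ x p (a ∷ q)) (cong (λ n → occ x p + (n + occ x q)) (δ-≢ x≢a))
    balp : BalancedExcept a p
    balp x x≢a with AvoidsAbab-separates a p q av x≢a
    ... | inj₁ x∉p = inj₁ x∉p
    ... | inj₂ x∉q = subst (λ n → n ≡ 0 ⊎ n ≡ k) (trans (occ-v x≢a) (trans (cong (occ x p +_) x∉q) (+-identityʳ _)))
                           (bal x x≢a)
    balq : BalancedExcept a q
    balq x x≢a with AvoidsAbab-separates a p q av x≢a
    ... | inj₂ x∉q = inj₁ x∉q
    ... | inj₁ x∉p = subst (λ n → n ≡ 0 ⊎ n ≡ k) (trans (occ-v x≢a) (cong (_+ occ x q) x∉p)) (bal x x≢a)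

  Surjective≤ : ℕ → Set
  Surjective≤ N = ∀ w → length w ≤ N → Balanced w → AvoidsAbab w → ∃ λ (es : Edges) → φE es ≡ w

  -- Cutting v at its first a gives the first compartment p; abab-avoidance keeps p and the rest label-disjoint.
  compartments : ∀ N → Surjective≤ N → ∀ j a v → length v ≤ N → occ a v ≡ suc j →
                 BalancedExcept a v → AvoidsAbab (a ∷ v) →
                 ∃₂ λ (cs : Vec Edges (suc j)) (es : Edges) → φC a cs ++ a ∷ φE es ≡ v
  compartments N surj j a v |v|≤N a∈v bal av with occ-split a v (subst (0 <_) (sym a∈v) (s≤s z≤n))
  ... | p , q , refl , a∉p = go j a∈v
    where
    balp : BalancedExcept a p
    balp = proj₁ (BalancedExcept-split a p q av bal)
    balq : BalancedExcept a q
    balq = proj₂ (BalancedExcept-split a p q av bal)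
    p-sub : p ⊆ p ++ a ∷ q
    p-sub = ++⁺ʳ (a ∷ q) ⊆-refl
    q-sub : q ⊆ p ++ a ∷ q
    q-sub = ++⁺ˡ p (a ∷ʳ ⊆-refl)
    occ-a-q : ∀ {j} → occ a (p ++ a ∷ q) ≡ suc j → occ a q ≡ j
    occ-a-q a∈v′ = suc-injective (trans (sym (trans (occ-++ a p (a ∷ q)) (cong₂ _+_ a∉p (occ-head a q)))) a∈v′)
    P : ∃ λ (es : Edges) → φE es ≡ p
    P = surj p (≤-trans (length-mono-≤ p-sub) |v|≤N) (BalancedExcept⇒Balanced p a∉p balp) (AvoidsAbab-⊆ (a ∷ʳ p-sub) av)
    go : ∀ j → occ a (p ++ a ∷ q) ≡ suc j → ∃₂ λ (cs : Vec Edges (suc j)) (es : Edges) → φC a cs ++ a ∷ φE es ≡ p ++ a ∷ q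
    go zero a∈v′ =
      let es , φes≡q = surj q (≤-trans (length-mono-≤ q-sub) |v|≤N) (BalancedExcept⇒Balanced q (occ-a-q a∈v′) balq)
                            (AvoidsAbab-⊆ (a ∷ʳ q-sub) av)
      in proj₁ P ∷v []v , es , cong₂ (λ u w → u ++ a ∷ w) (proj₂ P) φes≡q
    go (suc j) a∈v′
      with compartments N surj j a q (≤-trans (length-mono-≤ q-sub) |v|≤N) (occ-a-q a∈v′) balq
                        (AvoidsAbab-⊆ (refl ∷ q-sub) av)
    ... | c ∷v cs , es , eq =
      proj₁ P ∷v c ∷v cs , es , trans (++-assoc (φE (proj₁ P)) _ (a ∷ φE es)) (cong₂ (λ u w → u ++ a ∷ w) (proj₂ P) eq)

  φE-surjective≤ : ∀ N → Surjective≤ N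
  φE-surjective≤ N       []      _         _   _  = [] , refl
  φE-surjective≤ (suc N) (a ∷ w) (s≤s |w|≤N) bal av with bal a
  ... | inj₁ a∉ = ⊥-elim (1+n≢0 (trans (sym (occ-head a w)) a∉))
  ... | inj₂ a∈
    with compartments N (φE-surjective≤ N) h a w |w|≤N (suc-injective (trans (sym (occ-head a w)) a∈)) (Balanced-∷⁻ a w bal) av
  ...   | cs , es , eq = (a , node cs) ∷ es , cong (a ∷_) eq

  InT⇒Distinct : ∀ {n T} → InT k n T → Distinct (labelsE T)
  InT⇒Distinct {n} T∈ = Distinct-resp-↭ (↭-sym T∈) (Distinct-oneTo n)

  φ-InQ : ∀ {n} T → InT k n T → InQ k n (φ T)
  φ-InQ {n} T T∈ = occ≡⇒↭ (φE T) _ occ-φ≡ , AvoidsAbab⇒Avoids1212 (φE T) (φE-avoids T (InT⇒Distinct T∈))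
    where
    occ-φ≡ : ∀ x → occ x (φE T) ≡ occ x (concatMap (replicate k) (oneTo n))
    occ-φ≡ x = begin
      occ x (φE T)                                ≡⟨ occ-φE x T ⟩
      k * occ x (labelsE T)                       ≡⟨ cong (k *_) (↭⇒occ≡ T∈ x) ⟩
      k * occ x (oneTo n)                         ≡⟨ occ-concatMap-replicate k x (oneTo n) ⟨
      occ x (concatMap (replicate k) (oneTo n))   ∎
      where open ≡-Reasoning

  φ-surjective : ∀ {n} π → InQ k n π → ∃ λ T → InT k n T × φ T ≡ π
  φ-surjective {n} π (π↭ , av) =
    let T , φT≡π = φE-surjective≤ (length π) π ≤-refl balanced (Avoids1212⇒AvoidsAbab π av)
    in T , occ≡⇒↭ (labelsE T) (oneTo n) (λ x → *-cancelˡ-≡ _ _ k (begin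
         k * occ x (labelsE T)                       ≡⟨ occ-φE x T ⟨
         occ x (φE T)                                ≡⟨ cong (occ x) φT≡π ⟩
         occ x π                                     ≡⟨ occ-π x ⟩
         k * occ x (oneTo n)                         ∎)) ,
       φT≡π
    where
    open ≡-Reasoning
    occ-π : ∀ x → occ x π ≡ k * occ x (oneTo n)
    occ-π x = trans (↭⇒occ≡ π↭ x) (occ-concatMap-replicate k x (oneTo n))
    balanced : Balanced π
    balanced x with n≤1⇒n≡0∨n≡1 (occ≤1 (Distinct-oneTo n) x)
    ... | inj₁ x∉ = inj₁ (trans (occ-π x) (trans (cong (k *_) x∉) (*-zeroʳ k)))
    ... | inj₂ x∈ = inj₂ (trans (occ-π x) (trans (cong (k *_) x∈) (*-identityʳ k)))

lemma4p5 : (k : ℕ) → 2 ≤ k → (n : ℕ) →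
    ((T : Tree k) → InT k n T →
        InQ k n (φ T)
        × asc (φ T) ≡ cascT T
        × des (φ T) ≡ cdesT T
        × plat (φ T) ≡ empT T)
    × ((T T′ : Tree k) → InT k n T → InT k n T′ → φ T ≡ φ T′ → T ≡ T′)
    × ((π : List ℕ) → InQ k n π → ∃ λ T → InT k n T × φ T ≡ π)
lemma4p5 (suc (suc h)) (s≤s (s≤s z≤n)) n =
  (λ T T∈ → φ-InQ T T∈ , asc-φ T , des-φ T , plat-φ T (InT⇒Distinct T∈)) ,
  (λ T T′ T∈ T′∈ → φE-injective T T′ (InT⇒Distinct T∈) (InT⇒Distinct T′∈)) ,
  φ-surjective
  where open Walk h
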